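{- Let $(G,u)$ and $(H,v)$ be rooted graphs. For any integers $g,h,k\ge 0$ and $m\ge 2$, \[ X_{S^{ghk}(G,H,C_m)}=(m-1)\,X_{S^{gh}_{k+m-1}(G,H)}-\sum_{l=1}^{m-2}X_{S^{gh}_{k+l-1}(G,H)}\,X_{C_{m-l}}. \]
   Context: All graphs are finite; $X_G=\sum_{\kappa}\prod_{v\in V(G)}x_{\kappa(v)}$ over proper colorings $\kappa:V(G)\to\{1,2,\dots\}$ is the chromatic symmetric function. $C_m$ is the cycle on $m$ vertices rooted at any vertex; $C_2$ is understood as its underlying simple graph $K_2$. For nonnegative integers $\tau_1,\tau_2,\tau_3$ and rooted graphs $(G_i,u_i)$, $S^{\tau_1\tau_2\tau_3}(G_1,G_2,G_3)$ is obtained from a spider with center $c$ and three legs (paths from $c$, otherwise disjoint) of lengths $\tau_1,\tau_2,\tau_3$ by identifying the root $u_i$ with the far end of the $i$-th leg (with $c$ if $\tau_i=0$). Moreover $S^{\tau_1\tau_2}_{\tau_3}(G_1,G_2)=S^{\tau_1\tau_2\tau_3}(G_1,G_2,K_1)$, i.e., the third leg is a bare path. -}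

module Defs where

open import Data.Nat using (ℕ; zero; suc; _+_; _∸_; _≡ᵇ_)
open import Data.Integer using (ℤ; +_; _*_; _-_) renaming (_+_ to _+ℤ_)
open import Data.Fin using (Fin; zero; suc; inject₁; fromℕ; _↑ˡ_; _↑ʳ_; _≟_)
open import Data.Fin.Permutation.Components using (transpose)
open import Data.List using (List; []; _∷_; [_]; _++_; map; concatMap; allFin; length; filterᵇ; foldr; upTo)
open import Data.Bool.ListAction using (and)
open import Data.List.Relation.Unary.All using (All)
open import Data.Vec using (Vec; []; _∷_; lookup; zipWith)
open import Data.Product using (Σ; _×_; _,_; proj₁; proj₂)
open import Data.Bool using (Bool; not; _∧_)
open import Relation.Nullary using (does)
open import Relation.Binary.PropositionalEquality using (_≡_; _≢_)

record Graph : Set where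
  constructor graph
  field
    n : ℕ
    E : List (Fin n × Fin n)
open Graph public

record Rooted : Set where
  constructor rooted
  field
    k    : ℕ
    RE   : List (Fin (suc k) × Fin (suc k))
    root : Fin (suc k)
open Rooted public

-- no loops (graphs in the paper are simple; multi-edges do not matter for X)
Loopless : Rooted → Set
Loopless R = All (λ e → proj₁ e ≢ proj₂ e) (RE R)

K₁ : Rooted
K₁ = rooted 0 [] zero

-- cycle C_m rooted at vertex 0, vertices 0..m-1, edges j — j+1 and (m-1) — 0.
-- C₂ has edges 0—1 twice, i.e. underlying simple graph K₂.
-- (C 0 and C 1 are never used in the theorem.)
C : ℕ → Rooted
C zero    = K₁
C (suc k) = rooted k (pathE k ++ [ (fromℕ k , zero) ]) zero
  where
  pathE : (k : ℕ) → List (Fin (suc k) × Fin (suc k))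
  pathE k = map (λ j → (inject₁ j , suc j)) (allFin k)

mapE : ∀ {a b} → (Fin a → Fin b) → List (Fin a × Fin a) → List (Fin b × Fin b)
mapE f = map (λ e → (f (proj₁ e) , f (proj₂ e)))

addVertexAdj : (G : Graph) → Fin (n G) → Graph
addVertexAdj (graph n E) w = graph (suc n) (mapE inject₁ E ++ [ (inject₁ w , fromℕ n) ])

-- add a leg (path) of length τ starting at w; returns (graph, image of c, far end)
leg : (G : Graph) → Fin (n G) → Fin (n G) → ℕ → Σ Graph (λ H → Fin (n H) × Fin (n H))
leg G c w zero    = G , c , w
leg G c w (suc τ) = leg (addVertexAdj G w) (inject₁ c) (fromℕ (n G)) τ

-- glue rooted graph R to G by identifying root R with w; returns (graph, image of c)
glue : (G : Graph) → Fin (n G) → Fin (n G) → Rooted → Σ Graph (λ H → Fin (n H))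
glue (graph n E) c w (rooted k RE r) =
  graph (n + k) (mapE (_↑ˡ k) E ++ mapE φ RE) , c ↑ˡ k
  where
  ψ : Fin (suc k) → Fin (n + k)
  ψ zero    = w ↑ˡ k
  ψ (suc j) = n ↑ʳ j
  φ : Fin (suc k) → Fin (n + k)
  φ v = ψ (transpose r zero v)

attach : (G : Graph) → Fin (n G) → ℕ → Rooted → Σ Graph (λ H → Fin (n H))
attach G c τ R with leg G c c τ
... | G' , c' , e = glue G' c' e R

Spider : ℕ → ℕ → ℕ → Rooted → Rooted → Rooted → Graph
Spider τ₁ τ₂ τ₃ G₁ G₂ G₃ with attach (graph 1 []) zero τ₁ G₁
... | A₁ , c₁ with attach A₁ c₁ τ₂ G₂
... | A₂ , c₂ = proj₁ (attach A₂ c₂ τ₃ G₃)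

Spider₂ : ℕ → ℕ → ℕ → Rooted → Rooted → Graph
Spider₂ τ₁ τ₂ τ₃ G₁ G₂ = Spider τ₁ τ₂ τ₃ G₁ G₂ K₁

underlying : Rooted → Graph
underlying (rooted k RE _) = graph (suc k) RE

-- Formal power series in x₁,x₂,… with integer coefficients, given by
-- coefficient extraction: every monomial is x₁^α₁ ⋯ x_N^α_N for some N, α.

Series : Set
Series = (N : ℕ) → Vec ℕ N → ℤ

_≋_ : Series → Series → Set
A ≋ B = ∀ N (α : Vec ℕ N) → A N α ≡ B N α
infix 4 _≋_

_⊝_ : Series → Series → Series
(A ⊝ B) N α = A N α - B N α
infixl 6 _⊝_

_·_ : ℤ → Series → Series
(c · A) N α = c * A N α
infixl 7 _·_

below : ∀ {N} → Vec ℕ N → List (Vec ℕ N)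
below []      = [ [] ]
below (a ∷ α) = concatMap (λ b → map (b ∷_) (below α)) (upTo (suc a))

sumℤ : List ℤ → ℤ
sumℤ = foldr _+ℤ_ (+ 0)

_⊛_ : Series → Series → Series
(A ⊛ B) N α = sumℤ (map (λ β → A N β * B N (zipWith _∸_ α β)) (below α))
infixl 7 _⊛_

Σ[l=1to_]_ : ℕ → (ℕ → Series) → Series
(Σ[l=1to L ] F) N α = sumℤ (map (λ i → F (suc i) N α) (upTo L))

allFuns : (v N : ℕ) → List (Fin v → Fin N)
allFuns zero    N = [ (λ ()) ]
allFuns (suc v) N = concatMap (λ κ → map (λ c → cons c κ) (allFin N)) (allFuns v N)
  where
  cons : Fin N → (Fin v → Fin N) → Fin (suc v) → Fin N
  cons c κ zero    = c
  cons c κ (suc i) = κ i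

proper : (G : Graph) {N : ℕ} → (Fin (n G) → Fin N) → Bool
proper G κ = and (map (λ e → not (does (κ (proj₁ e) ≟ κ (proj₂ e)))) (E G))

hasType : (G : Graph) {N : ℕ} → Vec ℕ N → (Fin (n G) → Fin N) → Bool
hasType G {N} α κ =
  and (map (λ i → length (filterᵇ (λ v → does (κ v ≟ i)) (allFin (n G))) ≡ᵇ lookup α i) (allFin N))

-- coefficient of x₁^α₁⋯x_N^α_N in X_G = number of proper colourings κ
-- with |κ⁻¹(i)| = α_i for i ≤ N (hence using only colours 1..N)
X : Graph → Series
X G N α = + length (filterᵇ (λ κ → proper G κ ∧ hasType G α κ) (allFuns (n G) N))

-- Coefficientwise, X G counts proper colourings of G by type (the exponent vector of their
-- monomial). Every graph in the identity is the spider A = S^{gh}(G,H) with a tail hung at its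
-- centre c: a leg of length τ ending in the cycle C m (a tadpole), a bare leg, or a bare leg
-- beside a disjoint C m (the products ⊛). Summing over the colourings of A first, it suffices to
-- compare, for each colour of c, the weighted colour counts T(τ,m), P(τ), P(τ)·X(C m) of the tails.
--
-- Let u be the end of the leg, where C (m+1) is rooted, and b … ℓ the rest of the cycle. Then
--   [u≠b][b…ℓ proper path][ℓ≠u] + [b…ℓ proper cycle] = [u≠ℓ][b…ℓ proper cycle] + [u≠b][b…ℓ proper path]
-- (check the cases u = b and u = ℓ), which sums to T(j, m+1) + P(j)·X(C m) = T(j+1, m) + P(j+m).
-- As C 2 is a double edge, T(j, 2) = P(j+1), and telescoping down from C m gives
--   T(k, m) + Σ_{i < m-2} P(k+i)·X(C (m-1-i)) = (m-1)·P(k+m-1)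
-- in ℕ, which is the theorem once the sum is moved across in ℤ.

module Submission where

open import Defs
open import Data.Nat using (ℕ; zero; suc; _+_; _*_; _∸_; _≤_; _≡ᵇ_; s≤s)
open import Data.Nat.Properties hiding (_≟_)
open import Data.Fin using (Fin; zero; suc; inject₁; fromℕ; _↑ˡ_; _↑ʳ_; _≟_; splitAt)
open import Data.List using (List; []; _∷_; _++_; map; concatMap; allFin; tabulate; upTo; applyUpTo; length; filterᵇ)
import Data.List as List
import Data.List.Properties as List
open import Data.Bool using (Bool; true; false; not; _∧_)
open import Data.Bool.Properties using (∧-assoc; ∧-comm; ∧-identityʳ; ∧-zeroʳ)
open import Data.Bool.ListAction using (and)
open import Data.Vec using (Vec; []; _∷_; lookup; zipWith)
import Data.Vec as Vec
import Data.Vec.Properties as Vec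
open import Data.Vec.Functional using (Vector) renaming (_∷_ to _◃_; _++_ to _⧺_)
open import Data.Vec.Functional.Properties using (lookup-++ˡ; lookup-++ʳ; ++-cong)
open import Data.Sum.Properties using ([,]-map)
open import Data.Product using (Σ; _×_; _,_; proj₁; proj₂)
import Data.Integer as ℤ
import Data.Integer.Properties as ℤ
open import Algebra.Properties.Semiring.Sum +-*-semiring
  using (sum-syntax; sum-cong-≗; sum-init-last; ∑-distrib-+; ∑-comm; *-distribˡ-sum)
import Algebra.Properties.CommutativeSemigroup +-commutativeSemigroup as +-CS
import Algebra.Properties.CommutativeSemigroup *-commutativeSemigroup as *-CS
open import Relation.Nullary using (does; yes; no)
open import Relation.Nullary.Decidable using (dec-true; dec-false)
open import Function using (_∘_)
open import Relation.Binary.PropositionalEquality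

private variable
  A B : Set

sumOver : List A → (A → ℕ) → ℕ
sumOver []       f = 0
sumOver (x ∷ xs) f = f x + sumOver xs f

sumOver-cong : ∀ (xs : List A) {f g : A → ℕ} → f ≗ g → sumOver xs f ≡ sumOver xs g
sumOver-cong []       f≗g = refl
sumOver-cong (x ∷ xs) f≗g = cong₂ _+_ (f≗g x) (sumOver-cong xs f≗g)

sumOver-++ : ∀ (xs ys : List A) f → sumOver (xs ++ ys) f ≡ sumOver xs f + sumOver ys f
sumOver-++ []       ys f = refl
sumOver-++ (x ∷ xs) ys f = trans (cong (f x +_) (sumOver-++ xs ys f)) (sym (+-assoc (f x) _ _))

sumOver-distrib-+ : ∀ (xs : List A) f g → sumOver xs (λ x → f x + g x) ≡ sumOver xs f + sumOver xs g
sumOver-distrib-+ []       f g = refl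
sumOver-distrib-+ (x ∷ xs) f g =
  trans (cong (f x + g x +_) (sumOver-distrib-+ xs f g)) (+-CS.interchange (f x) (g x) _ _)

*-distribˡ-sumOver : ∀ c (xs : List A) f → c * sumOver xs f ≡ sumOver xs (λ x → c * f x)
*-distribˡ-sumOver c []       f = *-zeroʳ c
*-distribˡ-sumOver c (x ∷ xs) f =
  trans (*-distribˡ-+ c (f x) _) (cong (c * f x +_) (*-distribˡ-sumOver c xs f))

*-distribʳ-sumOver : ∀ c (xs : List A) f → sumOver xs f * c ≡ sumOver xs (λ x → f x * c)
*-distribʳ-sumOver c []       f = refl
*-distribʳ-sumOver c (x ∷ xs) f =
  trans (*-distribʳ-+ c (f x) _) (cong (f x * c +_) (*-distribʳ-sumOver c xs f))

sumOver-zero : ∀ (xs : List A) → sumOver xs (λ _ → 0) ≡ 0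
sumOver-zero []       = refl
sumOver-zero (x ∷ xs) = sumOver-zero xs

sumOver-comm : ∀ (xs : List A) (ys : List B) (f : A → B → ℕ) →
  sumOver xs (λ x → sumOver ys (f x)) ≡ sumOver ys (λ y → sumOver xs (λ x → f x y))
sumOver-comm []       ys f = sym (sumOver-zero ys)
sumOver-comm (x ∷ xs) ys f = trans (cong (sumOver ys (f x) +_) (sumOver-comm xs ys f))
  (sym (sumOver-distrib-+ ys (f x) _))

sumOver-map : ∀ (g : B → A) (xs : List B) f → sumOver (map g xs) f ≡ sumOver xs (f ∘ g)
sumOver-map g []       f = refl
sumOver-map g (x ∷ xs) f = cong (f (g x) +_) (sumOver-map g xs f)

sumOver-concatMap : ∀ (g : B → List A) (xs : List B) f →
  sumOver (concatMap g xs) f ≡ sumOver xs (λ x → sumOver (g x) f)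
sumOver-concatMap g []       f = refl
sumOver-concatMap g (x ∷ xs) f =
  trans (sumOver-++ (g x) _ f) (cong (sumOver (g x) f +_) (sumOver-concatMap g xs f))

sumOver-applyUpTo : ∀ (g : ℕ → ℕ) n f → sumOver (applyUpTo g n) f ≡ sumOver (upTo n) (f ∘ g)
sumOver-applyUpTo g zero    f = refl
sumOver-applyUpTo g (suc n) f = cong (f (g 0) +_)
  (trans (sumOver-applyUpTo (g ∘ suc) n f) (sym (sumOver-applyUpTo suc n (f ∘ g))))

sumOver-tabulate : ∀ n (g : Fin n → A) f → sumOver (tabulate g) f ≡ ∑[ i < n ] f (g i)
sumOver-tabulate zero    g f = refl
sumOver-tabulate (suc n) g f = cong (f (g zero) +_) (sumOver-tabulate n (g ∘ suc) f)

sumOver-allFin : ∀ n (f : Fin n → ℕ) → sumOver (allFin n) f ≡ ∑[ i < n ] f i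
sumOver-allFin n f = sumOver-tabulate n (λ i → i) f

∑-cong : ∀ n {f g : Fin n → ℕ} → f ≗ g → ∑[ i < n ] f i ≡ ∑[ i < n ] g i
∑-cong n f≗g = sum-cong-≗ f≗g

∑-↑ : ∀ m n (f : Fin (m + n) → ℕ) →
  ∑[ i < m + n ] f i ≡ ∑[ i < m ] f (i ↑ˡ n) + ∑[ j < n ] f (m ↑ʳ j)
∑-↑ zero    n f = refl
∑-↑ (suc m) n f = trans (cong (f zero +_) (∑-↑ m n (f ∘ suc))) (sym (+-assoc (f zero) _ _))

∑-sumOver-comm : ∀ n (ys : List A) (f : Fin n → A → ℕ) →
  ∑[ i < n ] sumOver ys (f i) ≡ sumOver ys (λ y → ∑[ i < n ] f i y)
∑-sumOver-comm n ys f = begin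
  ∑[ i < n ] sumOver ys (f i)                         ≡⟨ sumOver-allFin n _ ⟨
  sumOver (allFin n) (λ i → sumOver ys (f i))         ≡⟨ sumOver-comm (allFin n) ys f ⟩
  sumOver ys (λ y → sumOver (allFin n) (λ i → f i y)) ≡⟨ sumOver-cong ys (λ y → sumOver-allFin n _) ⟩
  sumOver ys (λ y → ∑[ i < n ] f i y)                 ∎
  where open ≡-Reasoning

⟦_⟧ : Bool → ℕ
⟦ true  ⟧ = 1
⟦ false ⟧ = 0

⟦∧⟧ : ∀ a b → ⟦ a ∧ b ⟧ ≡ ⟦ a ⟧ * ⟦ b ⟧
⟦∧⟧ true  b = sym (+-identityʳ ⟦ b ⟧)
⟦∧⟧ false b = refl

length-filterᵇ : ∀ (p : A → Bool) xs → length (filterᵇ p xs) ≡ sumOver xs (⟦_⟧ ∘ p)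
length-filterᵇ p []       = refl
length-filterᵇ p (x ∷ xs) with p x
... | true  = cong suc (length-filterᵇ p xs)
... | false = length-filterᵇ p xs

zipWith-+-identityˡ : ∀ {n} (t : Vec ℕ n) → zipWith _+_ (Vec.tabulate (λ _ → 0)) t ≡ t
zipWith-+-identityˡ []      = refl
zipWith-+-identityˡ (x ∷ t) = cong (x ∷_) (zipWith-+-identityˡ t)

infix 5 _=ᵛ_

_=ᵛ_ : ∀ {N} → Vec ℕ N → Vec ℕ N → Bool
[]      =ᵛ []      = true
(a ∷ u) =ᵛ (b ∷ w) = (a ≡ᵇ b) ∧ (u =ᵛ w)

and-lookup-≡ᵇ : ∀ {N} (u w : Vec ℕ N) →
  and (map (λ i → lookup u i ≡ᵇ lookup w i) (allFin N)) ≡ u =ᵛ w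
and-lookup-≡ᵇ []      []      = refl
and-lookup-≡ᵇ {suc N} (a ∷ u) (b ∷ w) = cong ((a ≡ᵇ b) ∧_)
  (trans (cong and (trans (List.map-tabulate {n = N} suc _) (sym (List.map-tabulate {n = N} (λ i → i) _))))
    (and-lookup-≡ᵇ u w))

⟦=ᵛ-∷⟧ : ∀ {N} a b (u w : Vec ℕ N) → ⟦ (a ∷ u) =ᵛ (b ∷ w) ⟧ ≡ ⟦ a ≡ᵇ b ⟧ * ⟦ u =ᵛ w ⟧
⟦=ᵛ-∷⟧ a b u w = ⟦∧⟧ (a ≡ᵇ b) (u =ᵛ w)

upTo-split : ∀ a u v →
  sumOver (upTo (suc a)) (λ b → ⟦ u ≡ᵇ b ⟧ * ⟦ v ≡ᵇ a ∸ b ⟧) ≡ ⟦ u + v ≡ᵇ a ⟧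
upTo-split a       zero    v = trans (cong (⟦ v ≡ᵇ a ⟧ + 0 +_)
  (trans (sumOver-applyUpTo suc a _) (sumOver-zero (upTo a))))
  (trans (+-identityʳ _) (+-identityʳ _))
upTo-split zero    (suc u) v = refl
upTo-split (suc a) (suc u) v = trans (sumOver-applyUpTo suc (suc a) _) (upTo-split a u v)

below-split : ∀ {N} (u v α : Vec ℕ N) →
  sumOver (below α) (λ β → ⟦ u =ᵛ β ⟧ * ⟦ v =ᵛ zipWith _∸_ α β ⟧) ≡ ⟦ zipWith _+_ u v =ᵛ α ⟧
below-split []       []       []      = refl
below-split (u₀ ∷ u) (v₀ ∷ v) (a ∷ α) = begin
  sumOver (below (a ∷ α)) δ
    ≡⟨ sumOver-concatMap (λ b → map (b ∷_) (below α)) (upTo (suc a)) δ ⟩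
  sumOver (upTo (suc a)) (λ b → sumOver (map (b ∷_) (below α)) δ)
    ≡⟨ sumOver-cong (upTo (suc a)) (λ b → trans (sumOver-map (b ∷_) (below α) δ)
         (trans (sumOver-cong (below α) (split b)) (sym (*-distribˡ-sumOver (δ₀ b) (below α) δ′)))) ⟩
  sumOver (upTo (suc a)) (λ b → δ₀ b * sumOver (below α) δ′)
    ≡⟨ *-distribʳ-sumOver (sumOver (below α) δ′) (upTo (suc a)) δ₀ ⟨
  sumOver (upTo (suc a)) δ₀ * sumOver (below α) δ′
    ≡⟨ cong₂ _*_ (upTo-split a u₀ v₀) (below-split u v α) ⟩
  ⟦ u₀ + v₀ ≡ᵇ a ⟧ * ⟦ zipWith _+_ u v =ᵛ α ⟧
    ≡⟨ ⟦=ᵛ-∷⟧ (u₀ + v₀) a (zipWith _+_ u v) α ⟨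
  ⟦ zipWith _+_ (u₀ ∷ u) (v₀ ∷ v) =ᵛ (a ∷ α) ⟧ ∎
  where
  open ≡-Reasoning
  δ : Vec ℕ _ → ℕ
  δ β = ⟦ (u₀ ∷ u) =ᵛ β ⟧ * ⟦ (v₀ ∷ v) =ᵛ zipWith _∸_ (a ∷ α) β ⟧
  δ′ : Vec ℕ _ → ℕ
  δ′ β = ⟦ u =ᵛ β ⟧ * ⟦ v =ᵛ zipWith _∸_ α β ⟧
  δ₀ : ℕ → ℕ
  δ₀ b = ⟦ u₀ ≡ᵇ b ⟧ * ⟦ v₀ ≡ᵇ a ∸ b ⟧
  split : ∀ b β → δ (b ∷ β) ≡ δ₀ b * δ′ β
  split b β = trans (cong₂ _*_ (⟦=ᵛ-∷⟧ u₀ b u β) (⟦=ᵛ-∷⟧ v₀ (a ∸ b) v _))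
    (*-CS.interchange ⟦ u₀ ≡ᵇ b ⟧ ⟦ u =ᵛ β ⟧ ⟦ v₀ ≡ᵇ a ∸ b ⟧ _)

sumℤ-+ : ∀ (xs : List A) (f : A → ℕ) → sumℤ (map (λ x → ℤ.+ f x) xs) ≡ ℤ.+ sumOver xs f
sumℤ-+ []       f = refl
sumℤ-+ (x ∷ xs) f = trans (cong (ℤ._+_ (ℤ.+ f x)) (sumℤ-+ xs f)) (sym (ℤ.pos-+ (f x) (sumOver xs f)))

-- Colourings with N colours

module Colourings (N : ℕ) where

  infixl 5 _▹_

  Colouring : ℕ → Set
  Colouring v = Vector (Fin N) v

  -- Sums over colourings run over Defs' list allFuns, which builds colourings with its own cons;
  -- without function extensionality, reindexing them needs summands that respect ≗.
  Extensional : ∀ {v} → (Colouring v → ℕ) → Set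
  Extensional f = ∀ {κ κ′} → κ ≗ κ′ → f κ ≡ f κ′

  _▹_ : ∀ {v} → Colouring v → Fin N → Colouring (suc v)
  _▹_ {zero}  κ c zero    = c
  _▹_ {suc v} κ c zero    = κ zero
  _▹_ {suc v} κ c (suc i) = (κ ∘ suc ▹ c) i

  ▹-inject₁ : ∀ {v} (κ : Colouring v) c → (κ ▹ c) ∘ inject₁ ≗ κ
  ▹-inject₁ {suc v} κ c zero    = refl
  ▹-inject₁ {suc v} κ c (suc i) = ▹-inject₁ (κ ∘ suc) c i

  ▹-last : ∀ {v} (κ : Colouring v) c → (κ ▹ c) (fromℕ v) ≡ c
  ▹-last {zero}  κ c = refl
  ▹-last {suc v} κ c = ▹-last (κ ∘ suc) c

  ▹-cong : ∀ {v} {κ κ′ : Colouring v} c → κ ≗ κ′ → κ ▹ c ≗ κ′ ▹ c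
  ▹-cong {zero}  c κ≗κ′ zero    = refl
  ▹-cong {suc v} c κ≗κ′ zero    = κ≗κ′ zero
  ▹-cong {suc v} c κ≗κ′ (suc i) = ▹-cong c (κ≗κ′ ∘ suc) i

  ◃-cong : ∀ {v} c {κ κ′ : Colouring v} → κ ≗ κ′ → c ◃ κ ≗ c ◃ κ′
  ◃-cong c κ≗κ′ zero    = refl
  ◃-cong c κ≗κ′ (suc i) = κ≗κ′ i

  ◃-▹ : ∀ {v} c (κ : Colouring v) d → c ◃ (κ ▹ d) ≗ (c ◃ κ) ▹ d
  ◃-▹ c κ d zero    = refl
  ◃-▹ c κ d (suc i) = refl

  ◃-⧺ : ∀ {v w} c (κ₁ : Colouring v) (κ₂ : Colouring w) → c ◃ (κ₁ ⧺ κ₂) ≗ (c ◃ κ₁) ⧺ κ₂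
  ◃-⧺ {v} c κ₁ κ₂ zero    = refl
  ◃-⧺ {v} c κ₁ κ₂ (suc i) = sym ([,]-map (splitAt v i))

  ∑col : ∀ v → (Colouring v → ℕ) → ℕ
  ∑col v f = sumOver (allFuns v N) f

  ∑col-cong : ∀ v {f g : Colouring v → ℕ} → f ≗ g → ∑col v f ≡ ∑col v g
  ∑col-cong v = sumOver-cong (allFuns v N)

  ∑col-◃ : ∀ v (f : Colouring (suc v) → ℕ) → Extensional f →
    ∑col (suc v) f ≡ ∑col v (λ κ → ∑[ c < N ] f (c ◃ κ))
  ∑col-◃ v f ext = trans (sumOver-concatMap _ (allFuns v N) f)
    (∑col-cong v (λ κ → trans (sumOver-map _ (allFin N) f)
      (trans (sumOver-allFin N _) (∑-cong N (λ c → ext (λ { zero → refl ; (suc i) → refl }))))))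

  ∑◃-extensional : ∀ {v} (f : Colouring (suc v) → ℕ) → Extensional f →
    Extensional {v} (λ κ → ∑[ c < N ] f (c ◃ κ))
  ∑◃-extensional f ext κ≗κ′ = ∑-cong N (λ c → ext (◃-cong c κ≗κ′))

  ∑▹-extensional : ∀ {v} (f : Colouring (suc v) → ℕ) → Extensional f →
    Extensional {v} (λ κ → ∑[ c < N ] f (κ ▹ c))
  ∑▹-extensional f ext κ≗κ′ = ∑-cong N (λ c → ext (▹-cong c κ≗κ′))

  ∑col-▹ : ∀ v (f : Colouring (suc v) → ℕ) → Extensional f →
    ∑col (suc v) f ≡ ∑col v (λ κ → ∑[ c < N ] f (κ ▹ c))
  ∑col-▹ zero    f ext = trans (∑col-◃ zero f ext) (cong (_+ 0) (∑-cong N (λ c → ext (λ { zero → refl }))))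
  ∑col-▹ (suc v) f ext = begin
    ∑col (suc (suc v)) f
      ≡⟨ ∑col-◃ (suc v) f ext ⟩
    ∑col (suc v) (λ κ → ∑[ c < N ] f (c ◃ κ))
      ≡⟨ ∑col-▹ v _ (∑◃-extensional f ext) ⟩
    ∑col v (λ κ → ∑[ d < N ] ∑[ c < N ] f (c ◃ (κ ▹ d)))
      ≡⟨ ∑col-cong v (λ κ → trans (∑-comm (λ d c → f (c ◃ (κ ▹ d))))
           (∑-cong N (λ c → ∑-cong N (λ d → ext (◃-▹ c κ d))))) ⟩
    ∑col v (λ κ → ∑[ c < N ] ∑[ d < N ] f ((c ◃ κ) ▹ d))
      ≡⟨ ∑col-◃ v _ (∑▹-extensional f ext) ⟨
    ∑col (suc v) (λ κ → ∑[ c < N ] f (κ ▹ c)) ∎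
    where open ≡-Reasoning

  ∑col-⧺ : ∀ v w (f : Colouring (v + w) → ℕ) → Extensional f →
    ∑col (v + w) f ≡ ∑col v (λ κ₁ → ∑col w (λ κ₂ → f (κ₁ ⧺ κ₂)))
  ∑col-⧺ zero    w f ext = sym (trans (+-identityʳ _) (∑col-cong w (λ κ₂ → ext (λ i → refl))))
  ∑col-⧺ (suc v) w f ext = begin
    ∑col (suc (v + w)) f
      ≡⟨ ∑col-◃ (v + w) f ext ⟩
    ∑col (v + w) (λ κ → ∑[ c < N ] f (c ◃ κ))
      ≡⟨ ∑col-⧺ v w _ (∑◃-extensional f ext) ⟩
    ∑col v (λ κ₁ → ∑col w (λ κ₂ → ∑[ c < N ] f (c ◃ (κ₁ ⧺ κ₂))))
      ≡⟨ ∑col-cong v (λ κ₁ → trans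
           (∑col-cong w (λ κ₂ → ∑-cong N (λ c → ext (◃-⧺ c κ₁ κ₂))))
           (sym (∑-sumOver-comm N (allFuns w N) (λ c κ₂ → f ((c ◃ κ₁) ⧺ κ₂))))) ⟩
    ∑col v (λ κ₁ → ∑[ c < N ] ∑col w (λ κ₂ → f ((c ◃ κ₁) ⧺ κ₂)))
      ≡⟨ ∑col-◃ v _ (λ κ₁≗κ₁′ →
           ∑col-cong w (λ κ₂ → ext (++-cong _ _ κ₁≗κ₁′ (λ _ → refl)))) ⟨
    ∑col (suc v) (λ κ₁ → ∑col w (λ κ₂ → f (κ₁ ⧺ κ₂))) ∎
    where open ≡-Reasoning

  Type : Set
  Type = Vec ℕ N

  count : ∀ {v} → Colouring v → Fin N → ℕ
  count {v} κ i = ∑[ x < v ] ⟦ does (κ x ≟ i) ⟧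

  type : ∀ {v} → Colouring v → Type
  type κ = Vec.tabulate (count κ)

  unit : Fin N → Type
  unit b = Vec.tabulate (λ i → ⟦ does (b ≟ i) ⟧)

  0ᵗ : Type
  0ᵗ = Vec.tabulate (λ _ → 0)

  infixl 6 _⊕_

  _⊕_ : Type → Type → Type
  _⊕_ = zipWith _+_

  ⊕-assoc : ∀ s t u → (s ⊕ t) ⊕ u ≡ s ⊕ (t ⊕ u)
  ⊕-assoc = Vec.zipWith-assoc +-assoc

  ⊕-comm : ∀ s t → s ⊕ t ≡ t ⊕ s
  ⊕-comm = Vec.zipWith-comm +-comm

  ⊕-identityˡ : ∀ t → 0ᵗ ⊕ t ≡ t
  ⊕-identityˡ = zipWith-+-identityˡ

  ⊕-identityʳ : ∀ t → t ⊕ 0ᵗ ≡ t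
  ⊕-identityʳ t = trans (⊕-comm t 0ᵗ) (⊕-identityˡ t)

  ⊕-tabulate : ∀ {n} (f g : Fin n → ℕ) →
    zipWith _+_ (Vec.tabulate f) (Vec.tabulate g) ≡ Vec.tabulate (λ i → f i + g i)
  ⊕-tabulate {zero}  f g = refl
  ⊕-tabulate {suc n} f g = cong (f zero + g zero ∷_) (⊕-tabulate (f ∘ suc) (g ∘ suc))

  type-cong : ∀ {v} {κ κ′ : Colouring v} → κ ≗ κ′ → type κ ≡ type κ′
  type-cong κ≗κ′ =
    Vec.tabulate-cong (λ i → ∑-cong _ (λ x → cong (λ c → ⟦ does (c ≟ i) ⟧) (κ≗κ′ x)))

  type-◃ : ∀ {v} b (κ : Colouring v) → type (b ◃ κ) ≡ unit b ⊕ type κ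
  type-◃ b κ = sym (⊕-tabulate _ _)

  type-▹ : ∀ {v} (κ : Colouring v) b → type (κ ▹ b) ≡ type κ ⊕ unit b
  type-▹ {v} κ b = trans (Vec.tabulate-cong split) (sym (⊕-tabulate _ _))
    where
    split : ∀ i → count (κ ▹ b) i ≡ count κ i + ⟦ does (b ≟ i) ⟧
    split i = trans (sum-init-last (λ x → ⟦ does ((κ ▹ b) x ≟ i) ⟧)) (cong₂ _+_
      (∑-cong v (λ x → cong (λ c → ⟦ does (c ≟ i) ⟧) (▹-inject₁ κ b x)))
      (cong (λ c → ⟦ does (c ≟ i) ⟧) (▹-last κ b)))

  type-⧺ : ∀ {v w} (κ₁ : Colouring v) (κ₂ : Colouring w) → type (κ₁ ⧺ κ₂) ≡ type κ₁ ⊕ type κ₂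
  type-⧺ {v} {w} κ₁ κ₂ = trans (Vec.tabulate-cong split) (sym (⊕-tabulate _ _))
    where
    split : ∀ i → count (κ₁ ⧺ κ₂) i ≡ count κ₁ i + count κ₂ i
    split i = trans (∑-↑ v w _) (cong₂ _+_
      (∑-cong v (λ x → cong (λ c → ⟦ does (c ≟ i) ⟧) (lookup-++ˡ κ₁ κ₂ x)))
      (∑-cong w (λ x → cong (λ c → ⟦ does (c ≟ i) ⟧) (lookup-++ʳ κ₁ κ₂ x))))

  _≠ᵇ_ : Fin N → Fin N → Bool
  a ≠ᵇ b = not (does (a ≟ b))

  ≠ᵇ-refl : ∀ a → a ≠ᵇ a ≡ false
  ≠ᵇ-refl a = cong not (dec-true (a ≟ a) refl)

  ≢⇒≠ᵇ : ∀ {a b} → a ≢ b → a ≠ᵇ b ≡ true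
  ≢⇒≠ᵇ {a} {b} a≢b = cong not (dec-false (a ≟ b) a≢b)

  ≠ᵇ-sym : ∀ a b → a ≠ᵇ b ≡ b ≠ᵇ a
  ≠ᵇ-sym a b with a ≟ b
  ... | yes refl = sym (≠ᵇ-refl a)
  ... | no  a≢b  = sym (≢⇒≠ᵇ (a≢b ∘ sym))

  properOn : ∀ {v} → Colouring v → List (Fin v × Fin v) → Bool
  properOn κ es = and (map (λ e → κ (proj₁ e) ≠ᵇ κ (proj₂ e)) es)

  properOn-++ : ∀ {v} (κ : Colouring v) es fs → properOn κ (es ++ fs) ≡ properOn κ es ∧ properOn κ fs
  properOn-++ κ []       fs = refl
  properOn-++ κ (e ∷ es) fs = trans (cong (ok e ∧_) (properOn-++ κ es fs)) (sym (∧-assoc (ok e) _ _))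
    where
    ok : Fin _ × Fin _ → Bool
    ok e = κ (proj₁ e) ≠ᵇ κ (proj₂ e)

  properOn-mapE : ∀ {v w} (φ : Fin v → Fin w) (κ : Colouring w) (κ′ : Colouring v) → κ ∘ φ ≗ κ′ →
    ∀ es → properOn κ (mapE φ es) ≡ properOn κ′ es
  properOn-mapE φ κ κ′ κφ≗κ′ []       = refl
  properOn-mapE φ κ κ′ κφ≗κ′ (e ∷ es) =
    cong₂ _∧_ (cong₂ _≠ᵇ_ (κφ≗κ′ (proj₁ e)) (κφ≗κ′ (proj₂ e)))
              (properOn-mapE φ κ κ′ κφ≗κ′ es)

  proper-cong : ∀ G {κ κ′ : Colouring (n G)} → κ ≗ κ′ → proper G κ ≡ proper G κ′
  proper-cong G κ≗κ′ =
    cong and (List.map-cong (λ e → cong₂ _≠ᵇ_ (κ≗κ′ (proj₁ e)) (κ≗κ′ (proj₂ e))) (E G))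

  colourSum : (G : Graph) → (Type → ℕ) → ℕ
  colourSum G h = ∑col (n G) (λ κ → ⟦ proper G κ ⟧ * h (type κ))

  colourSum-cong : ∀ G {h h′ : Type → ℕ} → (∀ t → h t ≡ h′ t) → colourSum G h ≡ colourSum G h′
  colourSum-cong G h≗h′ = ∑col-cong (n G) (λ κ → cong (⟦ proper G κ ⟧ *_) (h≗h′ (type κ)))

  hasType≡type=ᵛ : ∀ G α (κ : Colouring (n G)) → hasType G α κ ≡ type κ =ᵛ α
  hasType≡type=ᵛ G α κ = trans (cong and (List.map-cong count≡ (allFin N))) (and-lookup-≡ᵇ (type κ) α)
    where
    count≡ : ∀ i → (length (filterᵇ (λ v → does (κ v ≟ i)) (allFin (n G))) ≡ᵇ lookup α i)
                   ≡ (lookup (type κ) i ≡ᵇ lookup α i)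
    count≡ i = cong (_≡ᵇ lookup α i) (trans (length-filterᵇ _ (allFin (n G)))
      (trans (sumOver-allFin (n G) _) (sym (Vec.lookup∘tabulate (count κ) i))))

  X≡colourSum : ∀ G α → X G N α ≡ ℤ.+ colourSum G (λ t → ⟦ t =ᵛ α ⟧)
  X≡colourSum G α = cong ℤ.+_ (trans (length-filterᵇ _ (allFuns (n G) N))
    (∑col-cong (n G) (λ κ → trans (cong (λ b → ⟦ proper G κ ∧ b ⟧) (hasType≡type=ᵛ G α κ))
      (⟦∧⟧ (proper G κ) (type κ =ᵛ α)))))

  -- Legs and gluing

  -- Colourings of a path of τ new vertices hung from a vertex of colour a; h is given the colour
  -- of the far end and the type of the path.
  pathSum : ℕ → Fin N → (Fin N → Type → ℕ) → ℕ
  pathSum zero    a h = h a 0ᵗ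
  pathSum (suc τ) a h = ∑[ b < N ] (⟦ a ≠ᵇ b ⟧ * pathSum τ b (λ c t → h c (unit b ⊕ t)))

  pathSum-cong : ∀ τ a {h h′ : Fin N → Type → ℕ} → (∀ c t → h c t ≡ h′ c t) →
    pathSum τ a h ≡ pathSum τ a h′
  pathSum-cong zero    a h≗h′ = h≗h′ a 0ᵗ
  pathSum-cong (suc τ) a h≗h′ =
    ∑-cong N (λ b → cong (⟦ a ≠ᵇ b ⟧ *_) (pathSum-cong τ b (λ c t → h≗h′ c (unit b ⊕ t))))

  pathSum-distrib-+ : ∀ τ a (h h′ : Fin N → Type → ℕ) →
    pathSum τ a (λ c t → h c t + h′ c t) ≡ pathSum τ a h + pathSum τ a h′
  pathSum-distrib-+ zero    a h h′ = refl
  pathSum-distrib-+ (suc τ) a h h′ = trans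
    (∑-cong N (λ b → trans (cong (⟦ a ≠ᵇ b ⟧ *_) (pathSum-distrib-+ τ b (shift b h) (shift b h′)))
      (*-distribˡ-+ ⟦ a ≠ᵇ b ⟧ _ _)))
    (∑-distrib-+ (λ b → ⟦ a ≠ᵇ b ⟧ * pathSum τ b (shift b h))
                 (λ b → ⟦ a ≠ᵇ b ⟧ * pathSum τ b (shift b h′)))
    where
    shift : Fin N → (Fin N → Type → ℕ) → Fin N → Type → ℕ
    shift b h c t = h c (unit b ⊕ t)

  pathSum-+ : ∀ σ τ a (h : Fin N → Type → ℕ) →
    pathSum (σ + τ) a h ≡ pathSum σ a (λ b s → pathSum τ b (λ c t → h c (s ⊕ t)))
  pathSum-+ zero    τ a h = pathSum-cong τ a (λ c t → cong (h c) (sym (⊕-identityˡ t)))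
  pathSum-+ (suc σ) τ a h = ∑-cong N (λ b → cong (⟦ a ≠ᵇ b ⟧ *_) (trans (pathSum-+ σ τ b _)
    (pathSum-cong σ b (λ c s → pathSum-cong τ c (λ d t → cong (h d) (sym (⊕-assoc (unit b) s t)))))))

  colourSumAt : (G : Graph) → Fin (n G) → (Fin N → Type → ℕ) → ℕ
  colourSumAt G w h = ∑col (n G) (λ κ → ⟦ proper G κ ⟧ * h (κ w) (type κ))

  colourSumAt-cong : ∀ G w {h h′ : Fin N → Type → ℕ} → (∀ a s → h a s ≡ h′ a s) →
    colourSumAt G w h ≡ colourSumAt G w h′
  colourSumAt-cong G w h≗h′ = ∑col-cong (n G) (λ κ → cong (⟦ proper G κ ⟧ *_) (h≗h′ (κ w) (type κ)))

  colourSumAt-distrib-+ : ∀ G w (h h′ : Fin N → Type → ℕ) →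
    colourSumAt G w (λ a s → h a s + h′ a s) ≡ colourSumAt G w h + colourSumAt G w h′
  colourSumAt-distrib-+ G w h h′ = trans
    (∑col-cong (n G) (λ κ → *-distribˡ-+ ⟦ proper G κ ⟧ (h (κ w) (type κ)) _))
    (sumOver-distrib-+ (allFuns (n G) N) _ _)

  *-distribˡ-colourSumAt : ∀ m G w (h : Fin N → Type → ℕ) →
    m * colourSumAt G w h ≡ colourSumAt G w (λ a s → m * h a s)
  *-distribˡ-colourSumAt m G w h = trans (*-distribˡ-sumOver m (allFuns (n G) N) _)
    (∑col-cong (n G) (λ κ → *-CS.x∙yz≈y∙xz m ⟦ proper G κ ⟧ _))

  colourSumAt-sumOver : ∀ {A : Set} G w (xs : List A) (h : A → Fin N → Type → ℕ) →
    sumOver xs (λ x → colourSumAt G w (h x)) ≡ colourSumAt G w (λ a s → sumOver xs (λ x → h x a s))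
  colourSumAt-sumOver G w xs h = trans (sumOver-comm xs (allFuns (n G) N) _)
    (∑col-cong (n G) (λ κ → sym (*-distribˡ-sumOver ⟦ proper G κ ⟧ xs _)))

  proper-addVertexAdj : ∀ G w (κ : Colouring (n G)) b →
    proper (addVertexAdj G w) (κ ▹ b) ≡ proper G κ ∧ (κ w ≠ᵇ b)
  proper-addVertexAdj G w κ b = trans (properOn-++ (κ ▹ b) (mapE inject₁ (E G)) _)
    (cong₂ _∧_ (properOn-mapE inject₁ (κ ▹ b) κ (▹-inject₁ κ b) (E G))
               (trans (∧-identityʳ _) (cong₂ _≠ᵇ_ (▹-inject₁ κ b w) (▹-last κ b))))

  colourSumAt-leg : ∀ τ G c w h →
    colourSumAt (proj₁ (leg G c w τ)) (proj₂ (proj₂ (leg G c w τ))) h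
      ≡ colourSumAt G w (λ a s → pathSum τ a (λ b t → h b (s ⊕ t)))
  colourSumAt-leg zero    G c w h =
    ∑col-cong (n G) (λ κ → cong (λ t → ⟦ proper G κ ⟧ * h (κ w) t) (sym (⊕-identityʳ (type κ))))
  colourSumAt-leg (suc τ) G c w h = begin
    colourSumAt (proj₁ (leg G′ c′ (fromℕ (n G)) τ)) (proj₂ (proj₂ (leg G′ c′ (fromℕ (n G)) τ))) h
      ≡⟨ colourSumAt-leg τ G′ c′ (fromℕ (n G)) h ⟩
    colourSumAt G′ (fromℕ (n G)) (λ a s → pathSum τ a (λ b t → h b (s ⊕ t)))
      ≡⟨ ∑col-▹ (n G) summand summand-extensional ⟩
    ∑col (n G) (λ κ → ∑[ b < N ] summand (κ ▹ b))
      ≡⟨ ∑col-cong (n G) (λ κ → trans (∑-cong N (summand-▹ κ))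
           (sym (*-distribˡ-sum ⟦ proper G κ ⟧ (next κ)))) ⟩
    colourSumAt G w (λ a s → pathSum (suc τ) a (λ b t → h b (s ⊕ t))) ∎
    where
    open ≡-Reasoning
    G′ : Graph
    G′ = addVertexAdj G w
    c′ : Fin (n G′)
    c′ = inject₁ c
    summand : Colouring (suc (n G)) → ℕ
    summand κ = ⟦ proper G′ κ ⟧ * pathSum τ (κ (fromℕ (n G))) (λ b t → h b (type κ ⊕ t))
    summand-extensional : Extensional summand
    summand-extensional κ≗κ′ = cong₂ _*_ (cong ⟦_⟧ (proper-cong G′ κ≗κ′))
      (cong₂ (λ a s → pathSum τ a (λ b t → h b (s ⊕ t))) (κ≗κ′ _) (type-cong κ≗κ′))
    next : Colouring (n G) → Fin N → ℕ
    next κ b = ⟦ κ w ≠ᵇ b ⟧ * pathSum τ b (λ c t → h c (type κ ⊕ (unit b ⊕ t)))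
    summand-▹ : ∀ κ b → summand (κ ▹ b) ≡ ⟦ proper G κ ⟧ * next κ b
    summand-▹ κ b = trans (cong₂ _*_
      (trans (cong ⟦_⟧ (proper-addVertexAdj G w κ b)) (⟦∧⟧ (proper G κ) (κ w ≠ᵇ b)))
      (trans (cong (λ a → pathSum τ a (λ c t → h c (type (κ ▹ b) ⊕ t))) (▹-last κ b))
        (pathSum-cong τ b (λ c t → cong (h c)
          (trans (cong (_⊕ t) (type-▹ κ b)) (⊕-assoc (type κ) (unit b) t))))))
      (*-assoc ⟦ proper G κ ⟧ _ _)

  -- The root is precoloured a and does not count towards the type.
  rootedSum : Rooted → Fin N → (Type → ℕ) → ℕ
  rootedSum R a g = ∑col (k R) (λ z → ⟦ proper (underlying R) (a ◃ z) ⟧ * g (type z))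

  rootedSum-cong : ∀ R a {g g′ : Type → ℕ} → (∀ t → g t ≡ g′ t) → rootedSum R a g ≡ rootedSum R a g′
  rootedSum-cong R a g≗g′ =
    ∑col-cong (k R) (λ z → cong (⟦ proper (underlying R) (a ◃ z) ⟧ *_) (g≗g′ (type z)))

  proper-glue : ∀ G c w k RE (κ₁ : Colouring (n G)) (κ₂ : Colouring k) →
    proper (proj₁ (glue G c w (rooted k RE zero))) (κ₁ ⧺ κ₂)
      ≡ proper G κ₁ ∧ proper (graph (suc k) RE) (κ₁ w ◃ κ₂)
  proper-glue G c w k RE κ₁ κ₂ = trans (properOn-++ (κ₁ ⧺ κ₂) (mapE (_↑ˡ k) (E G)) _)
    (cong₂ _∧_ (properOn-mapE _ (κ₁ ⧺ κ₂) κ₁ (lookup-++ˡ κ₁ κ₂) (E G))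
               (properOn-mapE _ (κ₁ ⧺ κ₂) (κ₁ w ◃ κ₂)
                 (λ { zero → lookup-++ˡ κ₁ κ₂ w ; (suc j) → lookup-++ʳ κ₁ κ₂ j }) RE))

  colourSum-glue : ∀ G c w k RE (h : Type → ℕ) →
    colourSum (proj₁ (glue G c w (rooted k RE zero))) h
      ≡ colourSumAt G w (λ a s → rootedSum (rooted k RE zero) a (λ t → h (s ⊕ t)))
  colourSum-glue G c w k RE h = begin
    colourSum G′ h
      ≡⟨ ∑col-⧺ (n G) k (λ κ → ⟦ proper G′ κ ⟧ * h (type κ))
           (λ κ≗κ′ → cong₂ _*_ (cong ⟦_⟧ (proper-cong G′ κ≗κ′)) (cong h (type-cong κ≗κ′))) ⟩
    ∑col (n G) (λ κ₁ → ∑col k (λ κ₂ → ⟦ proper G′ (κ₁ ⧺ κ₂) ⟧ * h (type (κ₁ ⧺ κ₂))))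
      ≡⟨ ∑col-cong (n G) (λ κ₁ → trans (∑col-cong k (split κ₁))
           (sym (*-distribˡ-sumOver ⟦ proper G κ₁ ⟧ (allFuns k N) (summand κ₁)))) ⟩
    colourSumAt G w (λ a s → rootedSum (rooted k RE zero) a (λ t → h (s ⊕ t))) ∎
    where
    open ≡-Reasoning
    G′ : Graph
    G′ = proj₁ (glue G c w (rooted k RE zero))
    summand : Colouring (n G) → Colouring k → ℕ
    summand κ₁ κ₂ = ⟦ proper (graph (suc k) RE) (κ₁ w ◃ κ₂) ⟧ * h (type κ₁ ⊕ type κ₂)
    split : ∀ κ₁ κ₂ →
      ⟦ proper G′ (κ₁ ⧺ κ₂) ⟧ * h (type (κ₁ ⧺ κ₂)) ≡ ⟦ proper G κ₁ ⟧ * summand κ₁ κ₂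
    split κ₁ κ₂ = trans (cong₂ _*_
      (trans (cong ⟦_⟧ (proper-glue G c w k RE κ₁ κ₂)) (⟦∧⟧ (proper G κ₁) _))
      (cong h (type-⧺ κ₁ κ₂)))
      (*-assoc ⟦ proper G κ₁ ⟧ _ _)

  -- Cycles and tadpoles

  pathProper : ∀ {L} → Colouring (suc L) → Bool
  pathProper {L} z = and (List.tabulate (λ j → z (inject₁ j) ≠ᵇ z (suc j)))

  pathProper-▹ : ∀ {L} (z : Colouring (suc L)) y → pathProper (z ▹ y) ≡ pathProper z ∧ (z (fromℕ L) ≠ᵇ y)
  pathProper-▹ {zero}  z y = ∧-identityʳ _
  pathProper-▹ {suc L} z y =
    trans (cong (z zero ≠ᵇ z (suc zero) ∧_) (pathProper-▹ (z ∘ suc) y))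
      (sym (∧-assoc (z zero ≠ᵇ z (suc zero)) (pathProper (z ∘ suc)) _))

  cycleProper : ∀ {L} → Colouring (suc L) → Bool
  cycleProper {L} = proper (underlying (C (suc L)))

  cycleProper≡ : ∀ {L} (z : Colouring (suc L)) → cycleProper z ≡ pathProper z ∧ (z (fromℕ L) ≠ᵇ z zero)
  cycleProper≡ {L} z = trans (properOn-++ z (map (λ j → inject₁ j , suc j) (allFin L)) _)
    (cong₂ _∧_ (cong and (trans (sym (List.map-∘ (allFin L))) (List.map-tabulate (λ j → j) _))) (∧-identityʳ _))

  cycleProper-rotate : ∀ {L} (z : Colouring (suc L)) y → cycleProper (y ◃ z) ≡ cycleProper (z ▹ y)
  cycleProper-rotate {L} z y = begin
    cycleProper (y ◃ z)
      ≡⟨ cycleProper≡ (y ◃ z) ⟩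
    ((y ≠ᵇ z zero) ∧ pathProper z) ∧ (z (fromℕ L) ≠ᵇ y)
      ≡⟨ rotate (y ≠ᵇ z zero) (pathProper z) _ ⟩
    (pathProper z ∧ (z (fromℕ L) ≠ᵇ y)) ∧ (y ≠ᵇ z zero)
      ≡⟨ cong₂ _∧_ (pathProper-▹ z y) (cong (_≠ᵇ z zero) (▹-last z y)) ⟨
    pathProper (z ▹ y) ∧ ((z ▹ y) (fromℕ (suc L)) ≠ᵇ (z ▹ y) zero)
      ≡⟨ cycleProper≡ (z ▹ y) ⟨
    cycleProper (z ▹ y) ∎
    where
    open ≡-Reasoning
    rotate : ∀ x p q → (x ∧ p) ∧ q ≡ (p ∧ q) ∧ x
    rotate x p q = trans (∧-assoc x p q) (∧-comm x (p ∧ q))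

  cycle-deletion : ∀ u b ℓ p →
    ⟦ ((u ≠ᵇ b) ∧ p) ∧ (ℓ ≠ᵇ u) ⟧ + ⟦ p ∧ (ℓ ≠ᵇ b) ⟧
      ≡ ⟦ u ≠ᵇ ℓ ⟧ * ⟦ p ∧ (ℓ ≠ᵇ b) ⟧ + ⟦ u ≠ᵇ b ⟧ * ⟦ p ⟧
  cycle-deletion u b ℓ p with u ≟ b | u ≟ ℓ
  cycle-deletion u _ _ p     | yes refl | yes refl rewrite ≠ᵇ-refl u = cong ⟦_⟧ (∧-zeroʳ p)
  cycle-deletion u _ ℓ p     | yes refl | no u≢ℓ rewrite ≢⇒≠ᵇ (u≢ℓ ∘ sym) =
    sym (trans (+-identityʳ _) (+-identityʳ _))
  cycle-deletion u b _ true  | no u≢b   | yes refl rewrite ≢⇒≠ᵇ u≢b | ≠ᵇ-refl u = refl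
  cycle-deletion u b _ false | no u≢b   | yes refl = refl
  cycle-deletion u b ℓ true  | no u≢b   | no u≢ℓ rewrite ≢⇒≠ᵇ (u≢ℓ ∘ sym) =
    trans (+-comm 1 ⟦ ℓ ≠ᵇ b ⟧) (cong (_+ 1) (sym (+-identityʳ _)))
  cycle-deletion u b ℓ false | no u≢b   | no u≢ℓ = refl

  cycleProper-deletion : ∀ {L} u (z : Colouring (suc L)) →
    ⟦ cycleProper (u ◃ z) ⟧ + ⟦ cycleProper z ⟧
      ≡ ⟦ u ≠ᵇ z (fromℕ L) ⟧ * ⟦ cycleProper z ⟧ + ⟦ pathProper (u ◃ z) ⟧
  cycleProper-deletion {L} u z = begin
    ⟦ cycleProper (u ◃ z) ⟧ + ⟦ cycleProper z ⟧
      ≡⟨ cong₂ (λ x y → ⟦ x ⟧ + ⟦ y ⟧) (cycleProper≡ (u ◃ z)) (cycleProper≡ z) ⟩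
    ⟦ ((u ≠ᵇ b) ∧ p) ∧ (ℓ ≠ᵇ u) ⟧ + ⟦ p ∧ (ℓ ≠ᵇ b) ⟧
      ≡⟨ cycle-deletion u b ℓ p ⟩
    ⟦ u ≠ᵇ ℓ ⟧ * ⟦ p ∧ (ℓ ≠ᵇ b) ⟧ + ⟦ u ≠ᵇ b ⟧ * ⟦ p ⟧
      ≡⟨ cong₂ _+_ (cong (λ x → ⟦ u ≠ᵇ ℓ ⟧ * ⟦ x ⟧) (cycleProper≡ z)) (⟦∧⟧ (u ≠ᵇ b) p) ⟨
    ⟦ u ≠ᵇ ℓ ⟧ * ⟦ cycleProper z ⟧ + ⟦ pathProper (u ◃ z) ⟧ ∎
    where
    open ≡-Reasoning
    b ℓ : Fin N
    b = z zero
    ℓ = z (fromℕ L)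
    p : Bool
    p = pathProper z

  pathProper-cong : ∀ {L} {z z′ : Colouring (suc L)} → z ≗ z′ → pathProper z ≡ pathProper z′
  pathProper-cong z≗z′ =
    cong and (List.tabulate-cong (λ j → cong₂ _≠ᵇ_ (z≗z′ (inject₁ j)) (z≗z′ (suc j))))

  pathWeight : ∀ {L} → Fin N → (Fin N → Type → ℕ) → Colouring (suc L) → ℕ
  pathWeight {L} u h z = ⟦ pathProper (u ◃ z) ⟧ * h (z (fromℕ L)) (type z)

  pathWeight-extensional : ∀ {L} u h → Extensional (pathWeight {L} u h)
  pathWeight-extensional u h z≗z′ =
    cong₂ _*_ (cong ⟦_⟧ (pathProper-cong (◃-cong u z≗z′))) (cong₂ h (z≗z′ _) (type-cong z≗z′))

  pathSum≡∑col : ∀ L u (h : Fin N → Type → ℕ) → pathSum (suc L) u h ≡ ∑col (suc L) (pathWeight u h)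
  pathSum≡∑col zero u h = sym (trans (∑col-◃ 0 (pathWeight u h) (pathWeight-extensional u h)) (trans (+-identityʳ _)
    (∑-cong N (λ b → cong₂ (λ x t → ⟦ x ⟧ * h b t) (∧-identityʳ (u ≠ᵇ b)) (type-◃ {0} b (λ ()))))))
  pathSum≡∑col (suc L) u h = begin
    ∑[ b < N ] (⟦ u ≠ᵇ b ⟧ * pathSum (suc L) b (shift b))
      ≡⟨ ∑-cong N (λ b → cong (⟦ u ≠ᵇ b ⟧ *_) (pathSum≡∑col L b (shift b))) ⟩
    ∑[ b < N ] (⟦ u ≠ᵇ b ⟧ * ∑col (suc L) (pathWeight b (shift b)))
      ≡⟨ ∑-cong N (λ b → *-distribˡ-sumOver ⟦ u ≠ᵇ b ⟧ (allFuns (suc L) N) (pathWeight b (shift b))) ⟩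
    ∑[ b < N ] ∑col (suc L) (λ z → ⟦ u ≠ᵇ b ⟧ * pathWeight b (shift b) z)
      ≡⟨ ∑-sumOver-comm N (allFuns (suc L) N) (λ b z → ⟦ u ≠ᵇ b ⟧ * pathWeight b (shift b) z) ⟩
    ∑col (suc L) (λ z → ∑[ b < N ] (⟦ u ≠ᵇ b ⟧ * pathWeight b (shift b) z))
      ≡⟨ ∑col-cong (suc L) (λ z → ∑-cong N (prepend z)) ⟩
    ∑col (suc L) (λ z → ∑[ b < N ] pathWeight u h (b ◃ z))
      ≡⟨ ∑col-◃ (suc L) (pathWeight u h) (pathWeight-extensional u h) ⟨
    ∑col (suc (suc L)) (pathWeight u h) ∎
    where
    open ≡-Reasoning
    shift : Fin N → Fin N → Type → ℕ
    shift b c t = h c (unit b ⊕ t)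
    prepend : ∀ z b → ⟦ u ≠ᵇ b ⟧ * pathWeight b (shift b) z ≡ pathWeight u h (b ◃ z)
    prepend z b = trans (sym (*-assoc ⟦ u ≠ᵇ b ⟧ _ _)) (cong₂ _*_
      (sym (⟦∧⟧ (u ≠ᵇ b) (pathProper (b ◃ z)))) (cong (h (z (fromℕ L))) (sym (type-◃ b z))))

  cycleWeight : ∀ {L} → Fin N → (Type → ℕ) → Colouring (suc L) → ℕ
  cycleWeight {L} u g z = ⟦ u ≠ᵇ z (fromℕ L) ⟧ * (⟦ cycleProper z ⟧ * g (type z))

  rootedSum-C-rotate : ∀ c u (g : Type → ℕ) →
    ∑[ y < N ] (⟦ u ≠ᵇ y ⟧ * rootedSum (C (2 + c)) y (λ s → g (unit y ⊕ s)))
      ≡ ∑col (2 + c) (cycleWeight u g)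
  rootedSum-C-rotate c u g = begin
    ∑[ y < N ] (⟦ u ≠ᵇ y ⟧ * ∑col (suc c) (summand y))
      ≡⟨ ∑-cong N (λ y → *-distribˡ-sumOver ⟦ u ≠ᵇ y ⟧ (allFuns (suc c) N) (summand y)) ⟩
    ∑[ y < N ] ∑col (suc c) (λ z → ⟦ u ≠ᵇ y ⟧ * summand y z)
      ≡⟨ ∑-sumOver-comm N (allFuns (suc c) N) (λ y z → ⟦ u ≠ᵇ y ⟧ * summand y z) ⟩
    ∑col (suc c) (λ z → ∑[ y < N ] (⟦ u ≠ᵇ y ⟧ * summand y z))
      ≡⟨ ∑col-cong (suc c) (λ z → ∑-cong N (append z)) ⟩
    ∑col (suc c) (λ z → ∑[ y < N ] cycleWeight u g (z ▹ y))
      ≡⟨ ∑col-▹ (suc c) (cycleWeight u g) weight-ext ⟨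
    ∑col (2 + c) (cycleWeight u g) ∎
    where
    open ≡-Reasoning
    summand : Fin N → Colouring (suc c) → ℕ
    summand y z = ⟦ cycleProper (y ◃ z) ⟧ * g (unit y ⊕ type z)
    weight-ext : Extensional (cycleWeight u g)
    weight-ext z≗z′ = cong₂ _*_ (cong (λ x → ⟦ u ≠ᵇ x ⟧) (z≗z′ _))
      (cong₂ _*_ (cong ⟦_⟧ (proper-cong (underlying (C (2 + c))) z≗z′)) (cong g (type-cong z≗z′)))
    append : ∀ z y → ⟦ u ≠ᵇ y ⟧ * summand y z ≡ cycleWeight u g (z ▹ y)
    append z y = cong₂ _*_ (cong (λ x → ⟦ u ≠ᵇ x ⟧) (sym (▹-last z y))) (cong₂ _*_
      (cong ⟦_⟧ (cycleProper-rotate z y)) (cong g (trans (⊕-comm (unit y) (type z)) (sym (type-▹ z y)))))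

  rootedSum-C-deletion : ∀ c u (g : Type → ℕ) →
    rootedSum (C (3 + c)) u g + colourSum (underlying (C (2 + c))) g
      ≡ ∑[ y < N ] (⟦ u ≠ᵇ y ⟧ * rootedSum (C (2 + c)) y (λ s → g (unit y ⊕ s)))
        + pathSum (2 + c) u (λ _ s → g s)
  rootedSum-C-deletion c u g = begin
    rootedSum (C (3 + c)) u g + colourSum (underlying (C (2 + c))) g
      ≡⟨ sumOver-distrib-+ (allFuns (2 + c) N) _ _ ⟨
    ∑col (2 + c) (λ z → ⟦ cycleProper (u ◃ z) ⟧ * g (type z) + ⟦ cycleProper z ⟧ * g (type z))
      ≡⟨ ∑col-cong (2 + c) split ⟩
    ∑col (2 + c) (λ z → cycleWeight u g z + pathWeight u (λ _ s → g s) z)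
      ≡⟨ sumOver-distrib-+ (allFuns (2 + c) N) _ _ ⟩
    ∑col (2 + c) (cycleWeight u g) + ∑col (2 + c) (pathWeight u (λ _ s → g s))
      ≡⟨ cong₂ _+_ (rootedSum-C-rotate c u g) (pathSum≡∑col (suc c) u (λ _ s → g s)) ⟨
    ∑[ y < N ] (⟦ u ≠ᵇ y ⟧ * rootedSum (C (2 + c)) y (λ s → g (unit y ⊕ s)))
      + pathSum (2 + c) u (λ _ s → g s) ∎
    where
    open ≡-Reasoning
    split : ∀ z → ⟦ cycleProper (u ◃ z) ⟧ * g (type z) + ⟦ cycleProper z ⟧ * g (type z)
                ≡ cycleWeight u g z + pathWeight u (λ _ s → g s) z
    split z = begin
      ⟦ cycleProper (u ◃ z) ⟧ * g (type z) + ⟦ cycleProper z ⟧ * g (type z)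
        ≡⟨ *-distribʳ-+ (g (type z)) ⟦ cycleProper (u ◃ z) ⟧ _ ⟨
      (⟦ cycleProper (u ◃ z) ⟧ + ⟦ cycleProper z ⟧) * g (type z)
        ≡⟨ cong (_* g (type z)) (cycleProper-deletion u z) ⟩
      (⟦ u ≠ᵇ z (fromℕ (suc c)) ⟧ * ⟦ cycleProper z ⟧ + ⟦ pathProper (u ◃ z) ⟧) * g (type z)
        ≡⟨ *-distribʳ-+ (g (type z)) (⟦ u ≠ᵇ z (fromℕ (suc c)) ⟧ * ⟦ cycleProper z ⟧) _ ⟩
      ⟦ u ≠ᵇ z (fromℕ (suc c)) ⟧ * ⟦ cycleProper z ⟧ * g (type z) + ⟦ pathProper (u ◃ z) ⟧ * g (type z)
        ≡⟨ cong (_+ ⟦ pathProper (u ◃ z) ⟧ * g (type z)) (*-assoc ⟦ u ≠ᵇ z (fromℕ (suc c)) ⟧ _ _) ⟩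
      cycleWeight u g z + pathWeight u (λ _ s → g s) z ∎

  cycleSum : ℕ → (Type → ℕ) → ℕ
  cycleSum m = colourSum (underlying (C m))

  legSum : ℕ → Fin N → (Type → ℕ) → ℕ
  legSum τ a g = pathSum τ a (λ _ s → g s)

  tadpoleSum : ℕ → ℕ → Fin N → (Type → ℕ) → ℕ
  tadpoleSum τ m a g = pathSum τ a (λ b s → rootedSum (C m) b (λ t → g (s ⊕ t)))

  pathSum-suc : ∀ σ a (h : Fin N → Type → ℕ) →
    pathSum (suc σ) a h ≡ pathSum σ a (λ b s → pathSum 1 b (λ c t → h c (s ⊕ t)))
  pathSum-suc σ a h = trans (cong (λ τ → pathSum τ a h) (+-comm 1 σ)) (pathSum-+ σ 1 a h)

  rootedSum-C₂ : ∀ b (g : Type → ℕ) → rootedSum (C 2) b g ≡ pathSum 1 b (λ _ t → g t)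
  rootedSum-C₂ b g = trans (∑col-cong 1 (λ z → cong (λ x → ⟦ x ⟧ * g (type z)) (cycleProper₂ z)))
    (sym (pathSum≡∑col 0 b (λ _ t → g t)))
    where
    absorb : ∀ x → (x ∧ true) ∧ x ≡ x ∧ true
    absorb true  = refl
    absorb false = refl
    cycleProper₂ : ∀ (z : Colouring 1) → cycleProper (b ◃ z) ≡ pathProper (b ◃ z)
    cycleProper₂ z = trans (cycleProper≡ (b ◃ z))
      (trans (cong ((b ≠ᵇ z zero ∧ true) ∧_) (≠ᵇ-sym (z zero) b)) (absorb (b ≠ᵇ z zero)))

  tadpoleSum-deletion : ∀ c j a (g : Type → ℕ) →
    tadpoleSum j (3 + c) a g + legSum j a (λ s → cycleSum (2 + c) (λ t → g (s ⊕ t)))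
      ≡ tadpoleSum (suc j) (2 + c) a g + legSum (j + (2 + c)) a g
  tadpoleSum-deletion c j a g = begin
    tadpoleSum j (3 + c) a g + legSum j a (λ s → cycleSum (2 + c) (λ t → g (s ⊕ t)))
      ≡⟨ pathSum-distrib-+ j a _ _ ⟨
    pathSum j a (λ b s → rootedSum (C (3 + c)) b (λ t → g (s ⊕ t)) + cycleSum (2 + c) (λ t → g (s ⊕ t)))
      ≡⟨ pathSum-cong j a (λ b s → rootedSum-C-deletion c b (λ t → g (s ⊕ t))) ⟩
    pathSum j a (λ b s → pendant b s + pathSum (2 + c) b (λ _ t → g (s ⊕ t)))
      ≡⟨ pathSum-distrib-+ j a pendant _ ⟩
    pathSum j a pendant + pathSum j a (λ b s → pathSum (2 + c) b (λ _ t → g (s ⊕ t)))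
      ≡⟨ cong₂ _+_ tadpoleSum-suc (pathSum-+ j (2 + c) a (λ _ t → g t)) ⟨
    tadpoleSum (suc j) (2 + c) a g + legSum (j + (2 + c)) a g ∎
    where
    open ≡-Reasoning
    pendant : Fin N → Type → ℕ
    pendant b s = ∑[ y < N ] (⟦ b ≠ᵇ y ⟧ * rootedSum (C (2 + c)) y (λ t → g (s ⊕ (unit y ⊕ t))))
    unit-step : ∀ s y t → (s ⊕ (unit y ⊕ 0ᵗ)) ⊕ t ≡ s ⊕ (unit y ⊕ t)
    unit-step s y t = trans (cong (λ x → (s ⊕ x) ⊕ t) (⊕-identityʳ (unit y))) (⊕-assoc s (unit y) t)
    tadpoleSum-suc : tadpoleSum (suc j) (2 + c) a g ≡ pathSum j a pendant
    tadpoleSum-suc = trans (pathSum-suc j a (λ b s → rootedSum (C (2 + c)) b (λ t → g (s ⊕ t))))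
      (pathSum-cong j a (λ b s → ∑-cong N (λ y →
        cong (⟦ b ≠ᵇ y ⟧ *_) (rootedSum-cong (C (2 + c)) y (λ t → cong g (unit-step s y t))))))

  tadpoleSum-recurrence : ∀ c j a (g : Type → ℕ) →
    tadpoleSum j (2 + c) a g
      + sumOver (upTo c) (λ i → legSum (j + i) a (λ s → cycleSum (1 + c ∸ i) (λ t → g (s ⊕ t))))
      ≡ (1 + c) * legSum (j + (1 + c)) a g
  tadpoleSum-recurrence zero j a g = begin
    tadpoleSum j 2 a g + 0
      ≡⟨ +-identityʳ _ ⟩
    pathSum j a (λ b s → rootedSum (C 2) b (λ t → g (s ⊕ t)))
      ≡⟨ pathSum-cong j a (λ b s → rootedSum-C₂ b (λ t → g (s ⊕ t))) ⟩
    pathSum j a (λ b s → pathSum 1 b (λ _ t → g (s ⊕ t)))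
      ≡⟨ pathSum-+ j 1 a (λ _ t → g t) ⟨
    legSum (j + 1) a g
      ≡⟨ *-identityˡ _ ⟨
    1 * legSum (j + 1) a g ∎
    where open ≡-Reasoning
  tadpoleSum-recurrence (suc c) j a g = begin
    tadpoleSum j (3 + c) a g + (cycles 0 + sumOver (applyUpTo suc c) cycles)
      ≡⟨ cong (tadpoleSum j (3 + c) a g +_) (cong₂ _+_
           (cong (λ τ → legSum τ a (λ s → cycleSum (2 + c) (λ t → g (s ⊕ t)))) (+-identityʳ j))
           (trans (sumOver-applyUpTo suc c cycles) (sumOver-cong (upTo c) (λ i →
             cong (λ τ → legSum τ a (λ s → cycleSum (1 + c ∸ i) (λ t → g (s ⊕ t)))) (+-suc j i))))) ⟩
    tadpoleSum j (3 + c) a g + (first + S)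
      ≡⟨ +-assoc (tadpoleSum j (3 + c) a g) first S ⟨
    tadpoleSum j (3 + c) a g + first + S
      ≡⟨ cong (_+ S) (tadpoleSum-deletion c j a g) ⟩
    tadpoleSum (suc j) (2 + c) a g + L + S
      ≡⟨ +-CS.xy∙z≈xz∙y (tadpoleSum (suc j) (2 + c) a g) L S ⟩
    tadpoleSum (suc j) (2 + c) a g + S + L
      ≡⟨ cong (_+ L) (tadpoleSum-recurrence c (suc j) a g) ⟩
    (1 + c) * legSum (suc j + (1 + c)) a g + L
      ≡⟨ cong (λ τ → (1 + c) * legSum τ a g + L) (+-suc j (1 + c)) ⟨
    (1 + c) * L + L
      ≡⟨ +-comm ((1 + c) * L) L ⟩
    (2 + c) * L ∎
    where
    open ≡-Reasoning
    cycles : ℕ → ℕ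
    cycles i = legSum (j + i) a (λ s → cycleSum (2 + c ∸ i) (λ t → g (s ⊕ t)))
    first S L : ℕ
    first = legSum j a (λ s → cycleSum (2 + c) (λ t → g (s ⊕ t)))
    S = sumOver (upTo c) (λ i → legSum (suc j + i) a (λ s → cycleSum (1 + c ∸ i) (λ t → g (s ⊕ t))))
    L = legSum (j + (2 + c)) a g

  -- Tails attached to a graph

  colourSum-attach : ∀ A c τ k RE (h : Type → ℕ) →
    colourSum (proj₁ (attach A c τ (rooted k RE zero))) h
      ≡ colourSumAt A c (λ a s → pathSum τ a (λ b t →
          rootedSum (rooted k RE zero) b (λ u → h (s ⊕ (t ⊕ u)))))
  colourSum-attach A c τ k RE h = begin
    colourSum (proj₁ (attach A c τ (rooted k RE zero))) h
      ≡⟨ colourSum-glue (proj₁ L) (proj₁ (proj₂ L)) (proj₂ (proj₂ L)) k RE h ⟩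
    colourSumAt (proj₁ L) (proj₂ (proj₂ L)) (λ b t → rootedSum (rooted k RE zero) b (λ u → h (t ⊕ u)))
      ≡⟨ colourSumAt-leg τ A c c (λ b t → rootedSum (rooted k RE zero) b (λ u → h (t ⊕ u))) ⟩
    colourSumAt A c (λ a s → pathSum τ a (λ b t → rootedSum (rooted k RE zero) b (λ u → h ((s ⊕ t) ⊕ u))))
      ≡⟨ colourSumAt-cong A c (λ a s → pathSum-cong τ a (λ b t →
           rootedSum-cong (rooted k RE zero) b (λ u → cong h (⊕-assoc s t u)))) ⟩
    colourSumAt A c (λ a s → pathSum τ a (λ b t → rootedSum (rooted k RE zero) b (λ u → h (s ⊕ (t ⊕ u))))) ∎
    where
    open ≡-Reasoning
    L : Σ Graph (λ H → Fin (n H) × Fin (n H))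
    L = leg A c c τ

  colourSum-attach-K₁ : ∀ A c τ (h : Type → ℕ) →
    colourSum (proj₁ (attach A c τ K₁)) h ≡ colourSumAt A c (λ a s → legSum τ a (λ t → h (s ⊕ t)))
  colourSum-attach-K₁ A c τ h = trans (colourSum-attach A c τ 0 [] h)
    (colourSumAt-cong A c (λ a s → pathSum-cong τ a (λ b t →
      trans (+-identityʳ _) (trans (+-identityʳ _) (cong (λ x → h (s ⊕ x)) (⊕-identityʳ t))))))

  below-split-colourSum : ∀ H s α →
    sumOver (below α) (λ β → ⟦ s =ᵛ β ⟧ * colourSum H (λ u → ⟦ u =ᵛ zipWith _∸_ α β ⟧))
      ≡ colourSum H (λ u → ⟦ s ⊕ u =ᵛ α ⟧)
  below-split-colourSum H s α = begin
    sumOver (below α) (λ β → ⟦ s =ᵛ β ⟧ * ∑col (n H) (λ z → ⟦ proper H z ⟧ * rest β z))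
      ≡⟨ sumOver-cong (below α) (λ β → *-distribˡ-sumOver ⟦ s =ᵛ β ⟧ (allFuns (n H) N) _) ⟩
    sumOver (below α) (λ β → ∑col (n H) (λ z → ⟦ s =ᵛ β ⟧ * (⟦ proper H z ⟧ * rest β z)))
      ≡⟨ sumOver-comm (below α) (allFuns (n H) N) _ ⟩
    ∑col (n H) (λ z → sumOver (below α) (λ β → ⟦ s =ᵛ β ⟧ * (⟦ proper H z ⟧ * rest β z)))
      ≡⟨ ∑col-cong (n H) (λ z → trans
           (sumOver-cong (below α) (λ β → *-CS.x∙yz≈y∙xz ⟦ s =ᵛ β ⟧ ⟦ proper H z ⟧ (rest β z)))
           (sym (*-distribˡ-sumOver ⟦ proper H z ⟧ (below α) _))) ⟩
    ∑col (n H) (λ z → ⟦ proper H z ⟧ * sumOver (below α) (λ β → ⟦ s =ᵛ β ⟧ * rest β z))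
      ≡⟨ ∑col-cong (n H) (λ z → cong (⟦ proper H z ⟧ *_) (below-split s (type z) α)) ⟩
    colourSum H (λ u → ⟦ s ⊕ u =ᵛ α ⟧) ∎
    where
    open ≡-Reasoning
    rest : Type → Colouring (n H) → ℕ
    rest β z = ⟦ type z =ᵛ zipWith _∸_ α β ⟧

  X⊛X≡colourSum : ∀ G H α →
    (X G ⊛ X H) N α ≡ ℤ.+ colourSum G (λ s → colourSum H (λ u → ⟦ s ⊕ u =ᵛ α ⟧))
  X⊛X≡colourSum G H α = begin
    sumℤ (map (λ β → X G N β ℤ.* X H N (zipWith _∸_ α β)) (below α))
      ≡⟨ cong sumℤ (List.map-cong (λ β → trans (cong₂ ℤ._*_ (X≡colourSum G β) (X≡colourSum H _))
                                                (sym (ℤ.pos-* (δ G β) (δ H (α ∸ᵛ β))))) (below α)) ⟩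
    sumℤ (map (λ β → ℤ.+ (δ G β * δ H (α ∸ᵛ β))) (below α))
      ≡⟨ sumℤ-+ (below α) _ ⟩
    ℤ.+ sumOver (below α) (λ β → δ G β * δ H (α ∸ᵛ β))
      ≡⟨ cong ℤ.+_ convolution ⟩
    ℤ.+ colourSum G (λ s → colourSum H (λ u → ⟦ s ⊕ u =ᵛ α ⟧)) ∎
    where
    open ≡-Reasoning
    δ : Graph → Type → ℕ
    δ G β = colourSum G (λ u → ⟦ u =ᵛ β ⟧)
    _∸ᵛ_ : Type → Type → Type
    _∸ᵛ_ = zipWith _∸_
    convolution : sumOver (below α) (λ β → δ G β * δ H (α ∸ᵛ β)) ≡ colourSum G (λ s → colourSum H (λ u → ⟦ s ⊕ u =ᵛ α ⟧))
    convolution = begin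
      sumOver (below α) (λ β → δ G β * δ H (α ∸ᵛ β))
        ≡⟨ sumOver-cong (below α) (λ β → *-distribʳ-sumOver (δ H (α ∸ᵛ β)) (allFuns (n G) N) _) ⟩
      sumOver (below α) (λ β → ∑col (n G) (λ κ → ⟦ proper G κ ⟧ * ⟦ type κ =ᵛ β ⟧ * δ H (α ∸ᵛ β)))
        ≡⟨ sumOver-comm (below α) (allFuns (n G) N) _ ⟩
      ∑col (n G) (λ κ → sumOver (below α) (λ β → ⟦ proper G κ ⟧ * ⟦ type κ =ᵛ β ⟧ * δ H (α ∸ᵛ β)))
        ≡⟨ ∑col-cong (n G) (λ κ → trans (sumOver-cong (below α) (λ β → *-assoc ⟦ proper G κ ⟧ _ _))
                                        (sym (*-distribˡ-sumOver ⟦ proper G κ ⟧ (below α) _))) ⟩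
      ∑col (n G) (λ κ → ⟦ proper G κ ⟧ * sumOver (below α) (λ β → ⟦ type κ =ᵛ β ⟧ * δ H (α ∸ᵛ β)))
        ≡⟨ ∑col-cong (n G) (λ κ → cong (⟦ proper G κ ⟧ *_) (below-split-colourSum H (type κ) α)) ⟩
      colourSum G (λ s → colourSum H (λ u → ⟦ s ⊕ u =ᵛ α ⟧)) ∎

  attach-cycle-recurrenceℕ : ∀ A c k c′ (h : Type → ℕ) →
    colourSum (proj₁ (attach A c k (C (2 + c′)))) h
      + sumOver (upTo c′) (λ i →
          colourSum (proj₁ (attach A c (k + i) K₁)) (λ s → cycleSum (1 + c′ ∸ i) (λ u → h (s ⊕ u))))
      ≡ (1 + c′) * colourSum (proj₁ (attach A c (k + (1 + c′)) K₁)) h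
  attach-cycle-recurrenceℕ A c k c′ h = begin
    colourSum (proj₁ (attach A c k (C (2 + c′)))) h + sumOver (upTo c′) shorter
      ≡⟨ cong₂ _+_ (colourSum-attach A c k (suc c′) (Rooted.RE (C (2 + c′))) h)
           (trans (sumOver-cong (upTo c′) shorter≡) (colourSumAt-sumOver A c (upTo c′) shorter′)) ⟩
    colourSumAt A c tadpole + colourSumAt A c (λ a s → sumOver (upTo c′) (λ i → shorter′ i a s))
      ≡⟨ colourSumAt-distrib-+ A c tadpole (λ a s → sumOver (upTo c′) (λ i → shorter′ i a s)) ⟨
    colourSumAt A c (λ a s → tadpole a s + sumOver (upTo c′) (λ i → shorter′ i a s))
      ≡⟨ colourSumAt-cong A c (λ a s → tadpoleSum-recurrence c′ k a (λ t → h (s ⊕ t))) ⟩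
    colourSumAt A c (λ a s → (1 + c′) * legSum (k + (1 + c′)) a (λ t → h (s ⊕ t)))
      ≡⟨ trans (cong ((1 + c′) *_) (colourSum-attach-K₁ A c (k + (1 + c′)) h))
               (*-distribˡ-colourSumAt (1 + c′) A c (λ a s → legSum (k + (1 + c′)) a (λ t → h (s ⊕ t)))) ⟨
    (1 + c′) * colourSum (proj₁ (attach A c (k + (1 + c′)) K₁)) h ∎
    where
    open ≡-Reasoning
    tadpole : Fin N → Type → ℕ
    tadpole a s = tadpoleSum k (2 + c′) a (λ t → h (s ⊕ t))
    shorter : ℕ → ℕ
    shorter i = colourSum (proj₁ (attach A c (k + i) K₁)) (λ s → cycleSum (1 + c′ ∸ i) (λ u → h (s ⊕ u)))
    shorter′ : ℕ → Fin N → Type → ℕ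
    shorter′ i a s = legSum (k + i) a (λ t → cycleSum (1 + c′ ∸ i) (λ u → h (s ⊕ (t ⊕ u))))
    shorter≡ : ∀ i → shorter i ≡ colourSumAt A c (shorter′ i)
    shorter≡ i = trans (colourSum-attach-K₁ A c (k + i) (λ s → cycleSum (1 + c′ ∸ i) (λ u → h (s ⊕ u))))
      (colourSumAt-cong A c (λ a s → pathSum-cong (k + i) a (λ _ t →
        colourSum-cong (underlying (C (1 + c′ ∸ i))) (λ u → cong h (⊕-assoc s t u)))))

pos-+⇒- : ∀ {a s p} → a + s ≡ p → ℤ.+ a ≡ ℤ.+ p ℤ.- ℤ.+ s
pos-+⇒- {a} {s} refl = sym (begin
  ℤ.+ (a + s) ℤ.- ℤ.+ s           ≡⟨ cong (ℤ._- ℤ.+ s) (ℤ.pos-+ a s) ⟩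
  ℤ.+ a ℤ.+ ℤ.+ s ℤ.- ℤ.+ s       ≡⟨ ℤ.+-assoc (ℤ.+ a) (ℤ.+ s) (ℤ.- ℤ.+ s) ⟩
  ℤ.+ a ℤ.+ (ℤ.+ s ℤ.- ℤ.+ s)     ≡⟨ cong (ℤ._+_ (ℤ.+ a)) (ℤ.+-inverseʳ (ℤ.+ s)) ⟩
  ℤ.+ a ℤ.+ ℤ.0ℤ                  ≡⟨ ℤ.+-identityʳ (ℤ.+ a) ⟩
  ℤ.+ a                           ∎)
  where open ≡-Reasoning

attach-cycle-recurrence : ∀ A c k m → 2 ≤ m →
  X (proj₁ (attach A c k (C m))) ≋
    (ℤ.+ (m ∸ 1)) · X (proj₁ (attach A c (k + m ∸ 1) K₁))
    ⊝ (Σ[l=1to (m ∸ 2) ] λ l → X (proj₁ (attach A c (k + l ∸ 1) K₁)) ⊛ X (underlying (C (m ∸ l))))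
attach-cycle-recurrence A c k zero          ()
attach-cycle-recurrence A c k (suc zero)    (s≤s ())
attach-cycle-recurrence A c k (suc (suc c′)) _ N α = begin
  X (proj₁ (attach A c k (C (2 + c′)))) N α
    ≡⟨ X≡colourSum (proj₁ (attach A c k (C (2 + c′)))) α ⟩
  ℤ.+ colourSum (proj₁ (attach A c k (C (2 + c′)))) δ
    ≡⟨ pos-+⇒- (attach-cycle-recurrenceℕ A c k c′ δ) ⟩
  ℤ.+ ((1 + c′) * colourSum (leg+ (k + (1 + c′))) δ) ℤ.- ℤ.+ sumOver (upTo c′) shorter
    ≡⟨ cong₂ ℤ._-_ leading correction ⟩
  ((ℤ.+ (1 + c′)) · X (leg+ (k + suc (suc c′) ∸ 1))
    ⊝ (Σ[l=1to c′ ] λ l → X (leg+ (k + l ∸ 1)) ⊛ X (underlying (C (suc (suc c′) ∸ l))))) N α ∎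
  where
  open ≡-Reasoning
  open Colourings N
  leg+ : ℕ → Graph
  leg+ τ = proj₁ (attach A c τ K₁)
  δ : Type → ℕ
  δ t = ⟦ t =ᵛ α ⟧
  shorter : ℕ → ℕ
  shorter i = colourSum (leg+ (k + i)) (λ s → cycleSum (1 + c′ ∸ i) (λ u → δ (s ⊕ u)))
  leading : ℤ.+ ((1 + c′) * colourSum (leg+ (k + (1 + c′))) δ)
    ≡ ℤ.+ (1 + c′) ℤ.* X (leg+ (k + suc (suc c′) ∸ 1)) N α
  leading = begin
    ℤ.+ ((1 + c′) * colourSum (leg+ (k + (1 + c′))) δ)
      ≡⟨ ℤ.pos-* (1 + c′) _ ⟩
    ℤ.+ (1 + c′) ℤ.* ℤ.+ colourSum (leg+ (k + (1 + c′))) δ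
      ≡⟨ cong (ℤ.+ (1 + c′) ℤ.*_) (X≡colourSum (leg+ (k + (1 + c′))) α) ⟨
    ℤ.+ (1 + c′) ℤ.* X (leg+ (k + (1 + c′))) N α
      ≡⟨ cong (λ τ → ℤ.+ (1 + c′) ℤ.* X (leg+ τ) N α) (cong (_∸ 1) (+-suc k (suc c′))) ⟨
    ℤ.+ (1 + c′) ℤ.* X (leg+ (k + suc (suc c′) ∸ 1)) N α ∎
  correction : ℤ.+ sumOver (upTo c′) shorter
    ≡ (Σ[l=1to c′ ] λ l → X (leg+ (k + l ∸ 1)) ⊛ X (underlying (C (suc (suc c′) ∸ l)))) N α
  correction = sym (trans (cong sumℤ (List.map-cong term (upTo c′))) (sumℤ-+ (upTo c′) shorter))
    where
    term : ∀ i → (X (leg+ (k + suc i ∸ 1)) ⊛ X (underlying (C (1 + c′ ∸ i)))) N α ≡ ℤ.+ shorter i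
    term i = trans
      (cong (λ τ → (X (leg+ τ) ⊛ X (underlying (C (1 + c′ ∸ i)))) N α) (cong (_∸ 1) (+-suc k i)))
      (X⊛X≡colourSum (leg+ (k + i)) (underlying (C (1 + c′ ∸ i))) α)

open import Data.Integer using (+_)

-- The recurrence holds for any graph with a tail at any vertex.
theorem4p8 : (G H : Rooted) → Loopless G → Loopless H →
    (g h k m : ℕ) → 2 ≤ m →
    X (Spider g h k G H (C m)) ≋
      (+ (m ∸ 1)) · X (Spider₂ g h (k + m ∸ 1) G H)
      ⊝ (Σ[l=1to (m ∸ 2) ] λ l → X (Spider₂ g h (k + l ∸ 1) G H) ⊛ X (underlying (C (m ∸ l))))
theorem4p8 G H _ _ g h k m = attach-cycle-recurrence A₂ c₂ k m
  where
  A₁ : Σ Graph (λ H → Fin (n H))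
  A₁ = attach (graph 1 []) zero g G
  A₂ : Graph
  A₂ = proj₁ (attach (proj₁ A₁) (proj₂ A₁) h H)
  c₂ : Fin (n A₂)
  c₂ = proj₂ (attach (proj₁ A₁) (proj₂ A₁) h H)
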